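{- For every integer $n\geq 3$, $\chi_{la}(F_{n,1}\vee K_{1})=3$, where $F_{n,1}\vee K_1$ is the graph obtained from $F_{n,1}$ by adding one new vertex adjacent to all vertices of $F_{n,1}$.
   Context: All graphs are finite, simple and connected. For a graph $G$ with $m$ edges, a bijection $f:E(G)\to\{1,2,\dots,m\}$ is a local antimagic labeling if $\omega(u)\neq\omega(v)$ for every edge $uv$, where $\omega(u)=\sum_{e\in E(u)}f(e)$ and $E(u)$ is the set of edges incident with $u$. The local antimagic chromatic number $\chi_{la}(G)$ is the minimum number of distinct values of $\omega$ over all local antimagic labelings of $G$. The firecracker graph $F_{n,1}$ has vertex set $\{u_i,v_{i,1}:1\le i\le n\}$ and edge set $\{v_{i,1}v_{i+1,1}:1\le i\le n-1\}\cup\{u_iv_{i,1}:1\le i\le n\}$. -}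

module Defs where

open import Data.Nat using (ℕ; zero; suc; _+_; _*_; _∸_; _≤_)
open import Data.Nat.Properties using (_≟_)
open import Data.Fin using (Fin; toℕ)
open import Data.Nat.ListAction using (sum)
open import Data.List using (List; length; map; upTo; allFin; deduplicate; lookup; _++_)
open import Data.Product using (_×_; _,_; proj₁; proj₂; ∃)
open import Relation.Nullary using (¬_; does)
open import Data.Bool using (Bool; _∨_; if_then_else_)
open import Relation.Binary.PropositionalEquality using (_≡_)
open import Function.Definitions using (Bijective)

-- A finite graph given by its number of vertices (vertices are 0,…,nV-1)
-- and its list of edges (pairs of endpoints). Edge e is the e-th list entry.
record Graph : Set where
  field
    nV    : ℕ
    edges : List (ℕ × ℕ)

open Graph public

nE : Graph → ℕ
nE G = length (edges G)

-- an edge labeling: Fin m → Fin m, label of edge e is toℕ (f e) + 1 ∈ {1,…,m}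
Labeling : Graph → Set
Labeling G = Fin (nE G) → Fin (nE G)

label : (G : Graph) → Labeling G → Fin (nE G) → ℕ
label G f e = suc (toℕ (f e))

incident : ℕ → ℕ × ℕ → Bool
incident x (a , b) = does (x ≟ a) ∨ does (x ≟ b)

weight : (G : Graph) → Labeling G → ℕ → ℕ
weight G f x =
  sum (map (λ e → if incident x (lookup (edges G) e) then label G f e else 0)
           (allFin (nE G)))

IsLocalAntimagic : (G : Graph) → Labeling G → Set
IsLocalAntimagic G f =
  Bijective _≡_ _≡_ f ×
  ((e : Fin (nE G)) →
     ¬ (weight G f (proj₁ (lookup (edges G) e)) ≡ weight G f (proj₂ (lookup (edges G) e))))

numWeights : (G : Graph) → Labeling G → ℕ
numWeights G f = length (deduplicate _≟_ (map (weight G f) (upTo (nV G))))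

ChiLa≡ : Graph → ℕ → Set
ChiLa≡ G k =
  (∃ λ f → IsLocalAntimagic G f × numWeights G f ≡ k) ×
  ((f : Labeling G) → IsLocalAntimagic G f → k ≤ numWeights G f)

-- F_{n,1} ∨ K_1 : vertices u_i = i, v_{i,1} = n + i (0 ≤ i < n), new vertex w = 2n.
firecrackerJoinK1 : ℕ → Graph
firecrackerJoinK1 n = record
  { nV    = suc (2 * n)
  ; edges = map (λ i → (n + i , n + suc i)) (upTo (n ∸ 1))
         ++ map (λ i → (i , n + i)) (upTo n)
         ++ map (λ x → (x , 2 * n)) (upTo (2 * n))
  }

{-# OPTIONS --safe #-}
module Submission where

-- The vertices v₀, v₁ and the apex w span a triangle, so every local antimagic labelling
-- of F_{n,1} ∨ K₁ has at least three weights.  Conversely, the weights along the path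
-- v₀ … v_{n-1} must alternate between two values X and Y, each u_i taking the value that
-- its neighbour v_i does not take, and w gets a third value.  Labelling the path by the
-- zigzag n-1, 1, n-2, 2, … makes the path labels at v_i sum alternately to n-1 and n
-- (except at the end vertex v_{n-1}).  On each parity class of indices the labels of the
-- pendant edges and of the joins to u_i and v_i are then arithmetic progressions of
-- opposite slopes, so the weights are constant on each class, and the progressions fill
-- consecutive blocks of {1, …, 4n-1}.  For odd n = 2h+1 only the join at v_{2h} needs an
-- adjustment; for even n = 2r+4 the last four indices are patched by hand.

open import Defs
open import Data.Bool using (true; false; if_then_else_)
open import Data.Bool.Properties using (∨-zeroʳ)
open import Data.Empty using (⊥-elim)
open import Data.Fin using (Fin; toℕ; fromℕ<) renaming (zero to fzero; suc to fsuc)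
open import Data.Fin.Properties using (toℕ<n; toℕ-fromℕ<; toℕ-injective)
open import Data.List
  using (List; []; _∷_; _++_; length; map; upTo; applyUpTo; applyDownFrom; reverse; tabulate; lookup; deduplicate)
open import Data.List.Properties
  using (map-tabulate; length-++; length-map; length-upTo; map-upTo; reverse-applyUpTo; ++-assoc)
open import Data.List.Membership.Propositional using (_∈_)
open import Data.List.Membership.Propositional.Properties
  using (∈-map⁺; ∈-map⁻; ∈-upTo⁺; ∈-upTo⁻; ∈-applyUpTo⁺; ∈-applyUpTo⁻; ∈-∃++; ∈-lookup;
         ∈-++⁺ˡ; ∈-++⁺ʳ; ∈-++⁻; ∈-deduplicate⁺; ∈-deduplicate⁻)
open import Data.List.Relation.Binary.Permutation.Propositional
  using (_↭_; ↭-refl; ↭-sym; ↭-trans; ↭-prep; ↭-reflexive; ↭⇒↭ₛ; module PermutationReasoning)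
open import Data.List.Relation.Binary.Permutation.Propositional.Properties
  using (∈-resp-↭; ↭-reverse; ↭-length; ++-comm; ++⁺; shift; ++-commutativeMonoid)
import Data.List.Relation.Binary.Permutation.Setoid.Properties as Permutationₛ
open import Data.List.Relation.Binary.Subset.Propositional using (_⊆_)
open import Data.List.Relation.Unary.All as All using ()
open import Data.List.Relation.Unary.AllPairs using ([]; _∷_)
open import Data.List.Relation.Unary.Any using (here; there; index)
open import Data.List.Relation.Unary.Any.Properties using (lookup-index)
open import Data.List.Relation.Unary.Unique.Propositional using (Unique)
open import Data.List.Relation.Unary.Unique.Propositional.Properties using (upTo⁺)
open import Data.List.Relation.Unary.Unique.DecPropositional.Properties using (deduplicate-!)
open import Data.Nat
  using (ℕ; zero; suc; pred; _+_; _*_; _∸_; _≤_; _<_; _<?_; s≤s; z≤n; ⌊_/2⌋; ⌈_/2⌉; >-nonZero)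
open import Data.Nat.ListAction using (sum)
open import Data.Nat.Properties
open import Data.Nat.Tactic.RingSolver using (solve)
open import Data.Product using (_×_; _,_; proj₁; proj₂)
open import Data.Sum using (_⊎_; inj₁; inj₂)
import Data.Sum as Sum
open import Function using (_∘_; id)
open import Function.Definitions using (Bijective; Surjective)
open import Relation.Binary.PropositionalEquality
open import Relation.Nullary using (does; yes; no; contradiction)
open import Relation.Nullary.Decidable using (dec-true; dec-false)

open import Algebra.Solver.CommutativeMonoid (++-commutativeMonoid {A = ℕ})
  using (_⊕_; _⊜_) renaming (solve to rearrange)

private variable
  A : Set

-- Piecewise functions on ℕ

data Parity : ℕ → Set where
  even : ∀ k → Parity (k + k)
  odd  : ∀ k → Parity (suc (k + k))

parity : ∀ i → Parity i
parity zero = even zero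
parity (suc i) with parity i
... | even k = odd k
... | odd k rewrite sym (+-suc k k) = even (suc k)

interleave : (ℕ → A) → (ℕ → A) → ℕ → A
interleave f g zero    = f zero
interleave f g (suc i) = interleave g (f ∘ suc) i

interleave-even : ∀ (f g : ℕ → A) k → interleave f g (k + k) ≡ f k
interleave-even f g zero    = refl
interleave-even f g (suc k) rewrite +-suc k k = interleave-even (f ∘ suc) (g ∘ suc) k

interleave-odd : ∀ (f g : ℕ → A) k → interleave f g (suc (k + k)) ≡ g k
interleave-odd f g zero    = refl
interleave-odd f g (suc k) rewrite +-suc k k = interleave-odd (f ∘ suc) (g ∘ suc) k

interleave-shift : ∀ (f g : ℕ → A) k j → interleave f g (k + k + j) ≡ interleave (f ∘ (k +_)) (g ∘ (k +_)) j
interleave-shift f g zero    j = refl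
interleave-shift f g (suc k) j rewrite +-suc k k = interleave-shift (f ∘ suc) (g ∘ suc) k j

interleave-≥ : ∀ {c} {f g : ℕ → ℕ} → (∀ k → c ≤ f k) → (∀ k → c ≤ g k) → ∀ i → c ≤ interleave f g i
interleave-≥ c≤f c≤g zero    = c≤f zero
interleave-≥ c≤f c≤g (suc i) = interleave-≥ c≤g (c≤f ∘ suc) i

infixr 5 _⟨_⟩++_

_⟨_⟩++_ : (ℕ → A) → ℕ → (ℕ → A) → ℕ → A
(f ⟨ zero  ⟩++ g) i       = g i
(f ⟨ suc a ⟩++ g) zero    = f zero
(f ⟨ suc a ⟩++ g) (suc i) = ((f ∘ suc) ⟨ a ⟩++ g) i

⟨⟩++-< : ∀ (f g : ℕ → A) {a i} → i < a → (f ⟨ a ⟩++ g) i ≡ f i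
⟨⟩++-< f g {suc a} {zero}  _         = refl
⟨⟩++-< f g {suc a} {suc i} (s≤s i<a) = ⟨⟩++-< (f ∘ suc) g i<a

⟨⟩++-+ : ∀ (f g : ℕ → A) a i → (f ⟨ a ⟩++ g) (a + i) ≡ g i
⟨⟩++-+ f g zero    i = refl
⟨⟩++-+ f g (suc a) i = ⟨⟩++-+ (f ∘ suc) g a i

⟨⟩++-≡ : ∀ (f g : ℕ → A) a → (f ⟨ a ⟩++ g) a ≡ g 0
⟨⟩++-≡ f g zero    = refl
⟨⟩++-≡ f g (suc a) = ⟨⟩++-≡ (f ∘ suc) g a

⟨⟩++-≥ : ∀ {c} {f g : ℕ → ℕ} a → (∀ k → c ≤ f k) → (∀ k → c ≤ g k) → ∀ i → c ≤ (f ⟨ a ⟩++ g) i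
⟨⟩++-≥ zero    c≤f c≤g i       = c≤g i
⟨⟩++-≥ (suc a) c≤f c≤g zero    = c≤f zero
⟨⟩++-≥ (suc a) c≤f c≤g (suc i) = ⟨⟩++-≥ a (c≤f ∘ suc) c≤g i

applyUpTo-cong : ∀ {f g : ℕ → A} n → (∀ {i} → i < n → f i ≡ g i) → applyUpTo f n ≡ applyUpTo g n
applyUpTo-cong zero    f≗g = refl
applyUpTo-cong (suc n) f≗g = cong₂ _∷_ (f≗g (s≤s z≤n)) (applyUpTo-cong n (f≗g ∘ s≤s))

applyUpTo-+ : ∀ (f : ℕ → A) a b → applyUpTo f (a + b) ≡ applyUpTo f a ++ applyUpTo (f ∘ (a +_)) b
applyUpTo-+ f zero    b = refl
applyUpTo-+ f (suc a) b = cong (f 0 ∷_) (applyUpTo-+ (f ∘ suc) a b)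

applyUpTo-⟨⟩++ : ∀ (f g : ℕ → A) a b → applyUpTo (f ⟨ a ⟩++ g) (a + b) ≡ applyUpTo f a ++ applyUpTo g b
applyUpTo-⟨⟩++ f g zero    b = refl
applyUpTo-⟨⟩++ f g (suc a) b = cong (f 0 ∷_) (applyUpTo-⟨⟩++ (f ∘ suc) g a b)

applyUpTo-reflect : ∀ (f : ℕ → A) n → applyUpTo (λ k → f (n ∸ suc k)) n ↭ applyUpTo f n
applyUpTo-reflect f n = begin
  applyUpTo (λ k → f (n ∸ suc k)) n ≡⟨ downwards n ⟩
  applyDownFrom f n                 ≡⟨ reverse-applyUpTo f n ⟨
  reverse (applyUpTo f n)           ↭⟨ ↭-reverse (applyUpTo f n) ⟩
  applyUpTo f n                     ∎
  where
  open PermutationReasoning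
  downwards : ∀ n → applyUpTo (λ k → f (n ∸ suc k)) n ≡ applyDownFrom f n
  downwards zero    = refl
  downwards (suc n) = cong (f n ∷_) (downwards n)

applyUpTo-interleave : ∀ (f g : ℕ → A) i →
  applyUpTo (interleave f g) i ↭ applyUpTo f ⌈ i /2⌉ ++ applyUpTo g ⌊ i /2⌋
applyUpTo-interleave f g zero    = ↭-refl
applyUpTo-interleave f g (suc i) = begin
  f 0 ∷ applyUpTo (interleave g (f ∘ suc)) i                 ↭⟨ ↭-prep (f 0) (applyUpTo-interleave g (f ∘ suc) i) ⟩
  f 0 ∷ (applyUpTo g ⌈ i /2⌉ ++ applyUpTo (f ∘ suc) ⌊ i /2⌋) ↭⟨ ↭-prep (f 0) (++-comm (applyUpTo g ⌈ i /2⌉) _) ⟩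
  f 0 ∷ applyUpTo (f ∘ suc) ⌊ i /2⌋ ++ applyUpTo g ⌈ i /2⌉   ∎
  where open PermutationReasoning

applyUpTo-interleave-n+n : ∀ (f g : ℕ → A) k → applyUpTo (interleave f g) (k + k) ↭ applyUpTo f k ++ applyUpTo g k
applyUpTo-interleave-n+n f g k =
  subst₂ (λ a b → applyUpTo (interleave f g) (k + k) ↭ applyUpTo f a ++ applyUpTo g b)
    (sym (n≡⌈n+n/2⌉ k)) (sym (n≡⌊n+n/2⌋ k)) (applyUpTo-interleave f g (k + k))

applyUpTo-interleave-1+n+n : ∀ (f g : ℕ → A) k →
  applyUpTo (interleave f g) (suc (k + k)) ↭ applyUpTo f (suc k) ++ applyUpTo g k
applyUpTo-interleave-1+n+n f g k =
  subst₂ (λ a b → applyUpTo (interleave f g) (suc (k + k)) ↭ applyUpTo f a ++ applyUpTo g b)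
    (cong suc (sym (n≡⌊n+n/2⌋ k))) (sym (n≡⌈n+n/2⌉ k)) (applyUpTo-interleave f g (suc (k + k)))

range : ℕ → ℕ → List ℕ
range c l = applyUpTo (c +_) l

range-++ : ∀ {c d} a b → c + a ≡ d → range c a ++ range d b ≡ range c (a + b)
range-++ {c} a b refl =
  sym (trans (applyUpTo-+ (c +_) a b) (cong (range c a ++_) (applyUpTo-cong b λ {k} _ → sym (+-assoc c a k))))

intervals : List (ℕ × ℕ) → List ℕ
intervals []                 = []
intervals ((c , l) ∷ [])     = range c l
intervals ((c , l) ∷ p ∷ ps) = range c l ++ intervals (p ∷ ps)

data Consecutive : List (ℕ × ℕ) → Set where
  last : ∀ {c l} → Consecutive ((c , l) ∷ [])
  _∷_  : ∀ {c l d m ps} → c + l ≡ d → Consecutive ((d , m) ∷ ps) → Consecutive ((c , l) ∷ (d , m) ∷ ps)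

intervals-consecutive : ∀ {c l ps} → Consecutive ((c , l) ∷ ps) →
  intervals ((c , l) ∷ ps) ≡ range c (l + sum (map proj₂ ps))
intervals-consecutive {c} {l} last = cong (range c) (sym (+-identityʳ l))
intervals-consecutive {c} {l} (_∷_ {m = m} {ps} c+l≡d rest) =
  trans (cong (range c l ++_) (intervals-consecutive rest)) (range-++ l (m + sum (map proj₂ ps)) c+l≡d)

singletons : ∀ a b c d → a ∷ b ∷ c ∷ d ∷ [] ≡ range a 1 ++ range b 1 ++ range c 1 ++ range d 1
singletons a b c d = cong₂ _∷_ (sym (+-identityʳ a)) (cong₂ _∷_ (sym (+-identityʳ b))
                       (cong₂ _∷_ (sym (+-identityʳ c)) (cong₂ _∷_ (sym (+-identityʳ d)) refl)))

-- Labellings from permutations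

applyUpTo-injective : ∀ {f : ℕ → A} {n i j} → Unique (applyUpTo f n) → i < n → j < n → f i ≡ f j → i ≡ j
applyUpTo-injective {i = zero}  {zero}  _         _         _         _     = refl
applyUpTo-injective {f = f} {i = zero}  {suc j} (f0∉ ∷ _) _         (s≤s j<n) f0≡fj =
  contradiction f0≡fj (All.lookup f0∉ (∈-applyUpTo⁺ (f ∘ suc) j<n))
applyUpTo-injective {f = f} {i = suc i} {zero}  (f0∉ ∷ _) (s≤s i<n) _         fi≡f0 =
  contradiction (sym fi≡f0) (All.lookup f0∉ (∈-applyUpTo⁺ (f ∘ suc) i<n))
applyUpTo-injective {i = suc i} {suc j} (_ ∷ u)   (s≤s i<n) (s≤s j<n) fi≡fj =
  cong suc (applyUpTo-injective u i<n j<n fi≡fj)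

module _ {m} (ℓ : ℕ → ℕ) (ℓ↭ : applyUpTo ℓ m ↭ upTo m) where

  permutation-< : ∀ {e} → e < m → ℓ e < m
  permutation-< e<m = ∈-upTo⁻ (∈-resp-↭ ℓ↭ (∈-applyUpTo⁺ ℓ e<m))

  permutation : Fin m → Fin m
  permutation e = fromℕ< (permutation-< (toℕ<n e))

  toℕ-permutation : ∀ e → toℕ (permutation e) ≡ ℓ (toℕ e)
  toℕ-permutation e = toℕ-fromℕ< (permutation-< (toℕ<n e))

  permutation-bijective : Bijective _≡_ _≡_ permutation
  permutation-bijective = injective , surjective
    where
    unique : Unique (applyUpTo ℓ m)
    unique = Permutationₛ.Unique-resp-↭ (setoid ℕ) (↭⇒↭ₛ (↭-sym ℓ↭)) (upTo⁺ m)
    injective : ∀ {x y} → permutation x ≡ permutation y → x ≡ y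
    injective {x} {y} eq = toℕ-injective (applyUpTo-injective unique (toℕ<n x) (toℕ<n y)
      (trans (sym (toℕ-permutation x)) (trans (cong toℕ eq) (toℕ-permutation y))))
    surjective : Surjective _≡_ _≡_ permutation
    surjective y with e , e<m , y≡ℓe ← ∈-applyUpTo⁻ ℓ (∈-resp-↭ (↭-sym ℓ↭) (∈-upTo⁺ (toℕ<n y))) =
      fromℕ< e<m , λ { refl → toℕ-injective (trans (toℕ-permutation _) (trans (cong ℓ (toℕ-fromℕ< e<m)) (sym y≡ℓe))) }

-- Weights

unique⊆⇒length≤ : ∀ {xs ys : List ℕ} → Unique xs → xs ⊆ ys → length xs ≤ length ys
unique⊆⇒length≤ {[]}     _          _       = z≤n
unique⊆⇒length≤ {x ∷ xs} (x∉xs ∷ u) x∷xs⊆ys with ws , zs , refl ← ∈-∃++ (x∷xs⊆ys (here refl)) =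
  subst (suc (length xs) ≤_) (↭-length (↭-sym (shift x ws zs))) (s≤s (unique⊆⇒length≤ u xs⊆ws++zs))
  where
  xs⊆ws++zs : xs ⊆ ws ++ zs
  xs⊆ws++zs {z} z∈xs with ∈-resp-↭ (shift x ws zs) (x∷xs⊆ys (there z∈xs))
  ... | here z≡x = contradiction (sym z≡x) (All.lookup x∉xs z∈xs)
  ... | there z∈ = z∈

module _ (G : Graph) (f : Labeling G) where

  weights : List ℕ
  weights = deduplicate _≟_ (map (weight G f) (upTo (nV G)))

  weight-∈-weights : ∀ {x} → x < nV G → weight G f x ∈ weights
  weight-∈-weights x<n = ∈-deduplicate⁺ _≟_ (∈-map⁺ (weight G f) (∈-upTo⁺ x<n))

  3≤numWeights : ∀ {x y z} → x < nV G → y < nV G → z < nV G →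
    weight G f x ≢ weight G f y → weight G f x ≢ weight G f z → weight G f y ≢ weight G f z →
    3 ≤ numWeights G f
  3≤numWeights {x} {y} {z} x<n y<n z<n x≢y x≢z y≢z = unique⊆⇒length≤ distinct ⊆weights
    where
    distinct : Unique (weight G f x ∷ weight G f y ∷ weight G f z ∷ [])
    distinct = (x≢y All.∷ x≢z All.∷ All.[]) ∷ (y≢z All.∷ All.[]) ∷ All.[] ∷ []
    ⊆weights : (weight G f x ∷ weight G f y ∷ weight G f z ∷ []) ⊆ weights
    ⊆weights (here refl)                 = weight-∈-weights x<n
    ⊆weights (there (here refl))         = weight-∈-weights y<n
    ⊆weights (there (there (here refl))) = weight-∈-weights z<n

  numWeights≡3 : ∀ {x y z} → x < nV G → y < nV G → z < nV G →
    weight G f x ≢ weight G f y → weight G f x ≢ weight G f z → weight G f y ≢ weight G f z →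
    (∀ {v} → v < nV G → weight G f v ∈ (weight G f x ∷ weight G f y ∷ weight G f z ∷ [])) →
    numWeights G f ≡ 3
  numWeights≡3 {x} {y} {z} x<n y<n z<n x≢y x≢z y≢z three =
    ≤-antisym (unique⊆⇒length≤ (deduplicate-! _≟_ (map (weight G f) (upTo (nV G)))) weights⊆)
              (3≤numWeights x<n y<n z<n x≢y x≢z y≢z)
    where
    weights⊆ : weights ⊆ (weight G f x ∷ weight G f y ∷ weight G f z ∷ [])
    weights⊆ w∈ with v , v∈ , refl ← ∈-map⁻ (weight G f) (∈-deduplicate⁻ _≟_ (map (weight G f) (upTo (nV G))) w∈) =
      three (∈-upTo⁻ v∈)

  AdjacentWeightsDiffer : Set
  AdjacentWeightsDiffer = ∀ {a b} → (a , b) ∈ edges G → weight G f a ≢ weight G f b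

  isLocalAntimagic : Bijective _≡_ _≡_ f → AdjacentWeightsDiffer → IsLocalAntimagic G f
  isLocalAntimagic bijective differ = bijective , λ e → differ (∈-lookup e)

  adjacentWeightsDiffer : IsLocalAntimagic G f → AdjacentWeightsDiffer
  adjacentWeightsDiffer (_ , differ) ab∈ eq =
    differ (index ab∈) (subst (λ d → weight G f (proj₁ d) ≡ weight G f (proj₂ d)) (lookup-index ab∈) eq)

incidenceSum : ℕ → List (ℕ × ℕ) → (ℕ → ℕ) → ℕ
incidenceSum x []       g = 0
incidenceSum x (d ∷ ds) g = (if incident x d then g 0 else 0) + incidenceSum x ds (g ∘ suc)

weight≡incidenceSum : ∀ G (f : Labeling G) (ℓ : ℕ → ℕ) → (∀ e → toℕ (f e) ≡ ℓ (toℕ e)) →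
  ∀ x → weight G f x ≡ incidenceSum x (edges G) (suc ∘ ℓ)
weight≡incidenceSum G f ℓ f≗ℓ x =
  trans (cong sum (map-tabulate id λ e → if incident x (lookup (edges G) e) then label G f e else 0))
        (tabulate≡ (edges G) (label G f) (suc ∘ ℓ) (cong suc ∘ f≗ℓ))
  where
  tabulate≡ : ∀ ds (L : Fin (length ds) → ℕ) g → (∀ e → L e ≡ g (toℕ e)) →
    sum (tabulate λ e → if incident x (lookup ds e) then L e else 0) ≡ incidenceSum x ds g
  tabulate≡ []       L g L≗g = refl
  tabulate≡ (d ∷ ds) L g L≗g = cong₂ _+_ (cong (if incident x d then_else 0) (L≗g fzero))
                                         (tabulate≡ ds (L ∘ fsuc) (g ∘ suc) (L≗g ∘ fsuc))

incidenceSum-++ : ∀ x ds es g → incidenceSum x (ds ++ es) g ≡ incidenceSum x ds g + incidenceSum x es (g ∘ (length ds +_))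
incidenceSum-++ x []       es g = refl
incidenceSum-++ x (d ∷ ds) es g =
  trans (cong ((if incident x d then g 0 else 0) +_) (incidenceSum-++ x ds es (g ∘ suc)))
        (sym (+-assoc (if incident x d then g 0 else 0) _ _))

incidenceSum-cong : ∀ x ds {g h} → (∀ {i} → i < length ds → g i ≡ h i) → incidenceSum x ds g ≡ incidenceSum x ds h
incidenceSum-cong x []       g≗h = refl
incidenceSum-cong x (d ∷ ds) g≗h =
  cong₂ _+_ (cong (if incident x d then_else 0) (g≗h (s≤s z≤n))) (incidenceSum-cong x ds (g≗h ∘ s≤s))

incident-fst : ∀ a b → incident a (a , b) ≡ true
incident-fst a b rewrite dec-true (a ≟ a) refl = refl

incident-snd : ∀ a b → incident b (a , b) ≡ true
incident-snd a b rewrite dec-true (b ≟ b) refl = ∨-zeroʳ (does (b ≟ a))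

incident-≢ : ∀ {x a b} → x ≢ a → x ≢ b → incident x (a , b) ≡ false
incident-≢ {x} {a} {b} x≢a x≢b rewrite dec-false (x ≟ a) x≢a | dec-false (x ≟ b) x≢b = refl

module _ (x : ℕ) where

  incidenceSum-none : ∀ E k g → (∀ {i} → i < k → incident x (E i) ≡ false) →
    incidenceSum x (applyUpTo E k) g ≡ 0
  incidenceSum-none E zero    g none = refl
  incidenceSum-none E (suc k) g none rewrite none (s≤s (z≤n {k})) =
    incidenceSum-none (E ∘ suc) k (g ∘ suc) (none ∘ s≤s)

  incidenceSum-one : ∀ E k g {j} → j < k → incident x (E j) ≡ true →
    (∀ {i} → i < k → i ≢ j → incident x (E i) ≡ false) →
    incidenceSum x (applyUpTo E k) g ≡ g j
  incidenceSum-one E (suc k) g {zero}  _         hit miss rewrite hit =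
    trans (cong (g 0 +_) (incidenceSum-none (E ∘ suc) k (g ∘ suc) λ i<k → miss (s≤s i<k) λ ()))
          (+-identityʳ (g 0))
  incidenceSum-one E (suc k) g {suc j} (s≤s j<k) hit miss rewrite miss (s≤s (z≤n {k})) (λ ()) =
    incidenceSum-one (E ∘ suc) k (g ∘ suc) j<k hit λ i<k i≢j → miss (s≤s i<k) (i≢j ∘ suc-injective)

  incidenceSum-two : ∀ E k g {i j} → i < j → j < k → incident x (E i) ≡ true → incident x (E j) ≡ true →
    (∀ {l} → l < k → l ≢ i → l ≢ j → incident x (E l) ≡ false) →
    incidenceSum x (applyUpTo E k) g ≡ g i + g j
  incidenceSum-two E (suc k) g {zero}  {suc j} _         (s≤s j<k) hitᵢ hitⱼ miss rewrite hitᵢ =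
    cong (g 0 +_) (incidenceSum-one (E ∘ suc) k (g ∘ suc) j<k hitⱼ λ l<k l≢j →
      miss (s≤s l<k) (λ ()) (l≢j ∘ suc-injective))
  incidenceSum-two E (suc k) g {suc i} {suc j} (s≤s i<j) (s≤s j<k) hitᵢ hitⱼ miss
    rewrite miss (s≤s (z≤n {k})) (λ ()) (λ ()) =
    incidenceSum-two (E ∘ suc) k (g ∘ suc) i<j j<k hitᵢ hitⱼ λ l<k l≢i l≢j →
      miss (s≤s l<k) (l≢i ∘ suc-injective) (l≢j ∘ suc-injective)

  incidenceSum-all : ∀ E k g → (∀ {i} → i < k → incident x (E i) ≡ true) →
    incidenceSum x (applyUpTo E k) g ≡ sum (applyUpTo g k)
  incidenceSum-all E zero    g all = refl
  incidenceSum-all E (suc k) g all rewrite all (s≤s (z≤n {k})) =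
    cong (g 0 +_) (incidenceSum-all (E ∘ suc) k (g ∘ suc) (all ∘ s≤s))

sum-applyUpTo-≥ : ∀ {c} g k → (∀ {i} → i < k → c ≤ g i) → k * c ≤ sum (applyUpTo g k)
sum-applyUpTo-≥ g zero    c≤g = z≤n
sum-applyUpTo-≥ g (suc k) c≤g = +-mono-≤ (c≤g (s≤s z≤n)) (sum-applyUpTo-≥ (g ∘ suc) k (c≤g ∘ s≤s))

-- The graph F_{n,1} ∨ K₁

m<n∸1⇒1+m<n : ∀ {m n} → m < n ∸ 1 → suc m < n
m<n∸1⇒1+m<n {n = suc n} m<n = s≤s m<n

module _ (n : ℕ) where

  pathEdges pendantEdges joinEdges : List (ℕ × ℕ)
  pathEdges    = map (λ i → (n + i , n + suc i)) (upTo (n ∸ 1))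
  pendantEdges = map (λ i → (i , n + i)) (upTo n)
  joinEdges    = map (λ x → (x , 2 * n)) (upTo (2 * n))

  2n≡n+n : 2 * n ≡ n + n
  2n≡n+n = cong (n +_) (+-identityʳ n)

  n≤2n : n ≤ 2 * n
  n≤2n = m≤m+n n (1 * n)

  n+<2n : ∀ {i} → i < n → n + i < 2 * n
  n+<2n {i} i<n = subst (n + i <_) (sym 2n≡n+n) (+-monoʳ-< n i<n)

  n+i≢ : ∀ {i j} → i ≢ j → n + i ≢ n + j
  n+i≢ i≢j = i≢j ∘ +-cancelˡ-≡ n _ _

  <⇒≢n+ : ∀ {x} i → x < n → x ≢ n + i
  <⇒≢n+ i x<n = <⇒≢ (<-≤-trans x<n (m≤m+n n i))

  length-pathEdges : length pathEdges ≡ n ∸ 1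
  length-pathEdges = trans (length-map _ (upTo (n ∸ 1))) (length-upTo (n ∸ 1))

  length-pendantEdges : length pendantEdges ≡ n
  length-pendantEdges = trans (length-map _ (upTo n)) (length-upTo n)

  nE≡ : nE (firecrackerJoinK1 n) ≡ (n ∸ 1) + (n + (n + n))
  nE≡ = begin
    length (pathEdges ++ pendantEdges ++ joinEdges)             ≡⟨ length-++ pathEdges ⟩
    length pathEdges + length (pendantEdges ++ joinEdges)       ≡⟨ cong (length pathEdges +_) (length-++ pendantEdges) ⟩
    length pathEdges + (length pendantEdges + length joinEdges)
      ≡⟨ cong₂ _+_ length-pathEdges (cong₂ _+_ length-pendantEdges
           (trans (length-map _ (upTo (2 * n))) (trans (length-upTo (2 * n)) 2n≡n+n))) ⟩
    (n ∸ 1) + (n + (n + n))                                     ∎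
    where open ≡-Reasoning

  pathEdges≡ : pathEdges ≡ applyUpTo (λ i → (n + i , n + suc i)) (n ∸ 1)
  pathEdges≡ = map-upTo (λ i → (n + i , n + suc i)) (n ∸ 1)

  pendantEdges≡ : pendantEdges ≡ applyUpTo (λ i → (i , n + i)) n
  pendantEdges≡ = map-upTo (λ i → (i , n + i)) n

  joinEdges≡ : joinEdges ≡ applyUpTo (λ x → (x , 2 * n)) (2 * n)
  joinEdges≡ = map-upTo (λ x → (x , 2 * n)) (2 * n)

  incidenceSum-path-first : ∀ g → 0 < n ∸ 1 → incidenceSum (n + 0) pathEdges g ≡ g 0
  incidenceSum-path-first g 0<k = trans (cong (λ es → incidenceSum (n + 0) es g) pathEdges≡)
    (incidenceSum-one (n + 0) _ (n ∸ 1) g 0<k (incident-fst (n + 0) (n + 1))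
      λ {i} _ i≢0 → incident-≢ (n+i≢ (i≢0 ∘ sym)) (n+i≢ λ ()))

  incidenceSum-path-inner : ∀ g {j} → suc j < n ∸ 1 → incidenceSum (n + suc j) pathEdges g ≡ g j + g (suc j)
  incidenceSum-path-inner g {j} j+1<k = trans (cong (λ es → incidenceSum (n + suc j) es g) pathEdges≡)
    (incidenceSum-two (n + suc j) _ (n ∸ 1) g ≤-refl j+1<k
      (incident-snd (n + j) (n + suc j)) (incident-fst (n + suc j) (n + suc (suc j)))
      λ {l} _ l≢j l≢j+1 → incident-≢ (n+i≢ (l≢j+1 ∘ sym)) (n+i≢ (l≢j ∘ suc-injective ∘ sym)))

  incidenceSum-path-last : ∀ g → 0 < n ∸ 1 → incidenceSum (n + (n ∸ 1)) pathEdges g ≡ g (pred (n ∸ 1))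
  incidenceSum-path-last g 0<k =
    trans (cong (λ v → incidenceSum (n + v) pathEdges g) (sym k≡1+j))
      (trans (cong (λ es → incidenceSum (n + suc j) es g) pathEdges≡)
        (incidenceSum-one (n + suc j) _ (n ∸ 1) g (subst (j <_) k≡1+j ≤-refl) (incident-snd (n + j) (n + suc j))
          λ {l} l<k l≢j → incident-≢ (n+i≢ λ j+1≡l → <-irrefl (trans (sym j+1≡l) k≡1+j) l<k)
                                     (n+i≢ (l≢j ∘ suc-injective ∘ sym))))
    where
    j : ℕ
    j = pred (n ∸ 1)
    k≡1+j : suc j ≡ n ∸ 1
    k≡1+j = suc-pred (n ∸ 1) {{>-nonZero 0<k}}

  -- The class labels are 0-based: edge e carries the label suc (edgeLabel e).
  module EdgeLabels (pathLabel pendantLabel uLabel vLabel : ℕ → ℕ) where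

    edgeLabel : ℕ → ℕ
    edgeLabel = pathLabel ⟨ n ∸ 1 ⟩++ pendantLabel ⟨ n ⟩++ uLabel ⟨ n ⟩++ vLabel

    labels : List ℕ
    labels = applyUpTo pathLabel (n ∸ 1) ++ applyUpTo pendantLabel n ++ applyUpTo uLabel n ++ applyUpTo vLabel n

    applyUpTo-edgeLabel : applyUpTo edgeLabel (nE (firecrackerJoinK1 n)) ≡ labels
    applyUpTo-edgeLabel = begin
      applyUpTo edgeLabel (nE (firecrackerJoinK1 n))       ≡⟨ cong (applyUpTo edgeLabel) nE≡ ⟩
      applyUpTo edgeLabel ((n ∸ 1) + (n + (n + n)))        ≡⟨ applyUpTo-⟨⟩++ pathLabel _ (n ∸ 1) (n + (n + n)) ⟩
      applyUpTo pathLabel (n ∸ 1) ++ applyUpTo (pendantLabel ⟨ n ⟩++ uLabel ⟨ n ⟩++ vLabel) (n + (n + n))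
        ≡⟨ cong (applyUpTo pathLabel (n ∸ 1) ++_) (applyUpTo-⟨⟩++ pendantLabel _ n (n + n)) ⟩
      applyUpTo pathLabel (n ∸ 1) ++ applyUpTo pendantLabel n ++ applyUpTo (uLabel ⟨ n ⟩++ vLabel) (n + n)
        ≡⟨ cong (λ xs → applyUpTo pathLabel (n ∸ 1) ++ applyUpTo pendantLabel n ++ xs) (applyUpTo-⟨⟩++ uLabel vLabel n n) ⟩
      labels                                               ∎
      where open ≡-Reasoning

    module Permuted (labels↭ : labels ↭ upTo ((n ∸ 1) + (n + (n + n)))) where

      private
        edgeLabel↭ : applyUpTo edgeLabel (nE (firecrackerJoinK1 n)) ↭ upTo (nE (firecrackerJoinK1 n))
        edgeLabel↭ = ↭-trans (↭-reflexive applyUpTo-edgeLabel) (subst (λ m → labels ↭ upTo m) (sym nE≡) labels↭)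

      labeling : Labeling (firecrackerJoinK1 n)
      labeling = permutation edgeLabel edgeLabel↭

      labeling-bijective : Bijective _≡_ _≡_ labeling
      labeling-bijective = permutation-bijective edgeLabel edgeLabel↭

      weight-decomposition : ∀ x → weight (firecrackerJoinK1 n) labeling x ≡
        incidenceSum x pathEdges (suc ∘ pathLabel) +
        (incidenceSum x pendantEdges (suc ∘ pendantLabel) + incidenceSum x joinEdges (suc ∘ (uLabel ⟨ n ⟩++ vLabel)))
      weight-decomposition x = begin
        weight (firecrackerJoinK1 n) labeling x
          ≡⟨ weight≡incidenceSum (firecrackerJoinK1 n) labeling edgeLabel (toℕ-permutation edgeLabel edgeLabel↭) x ⟩
        incidenceSum x (pathEdges ++ pendantEdges ++ joinEdges) (suc ∘ edgeLabel)
          ≡⟨ incidenceSum-++ x pathEdges _ (suc ∘ edgeLabel) ⟩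
        incidenceSum x pathEdges (suc ∘ edgeLabel) +
        incidenceSum x (pendantEdges ++ joinEdges) (suc ∘ edgeLabel ∘ (length pathEdges +_))
          ≡⟨ cong₂ _+_ (incidenceSum-cong x pathEdges λ i<l →
                          cong suc (⟨⟩++-< pathLabel _ (subst (_ <_) length-pathEdges i<l)))
                       (incidenceSum-++ x pendantEdges joinEdges _) ⟩
        incidenceSum x pathEdges (suc ∘ pathLabel) +
        (incidenceSum x pendantEdges (suc ∘ edgeLabel ∘ (length pathEdges +_)) +
         incidenceSum x joinEdges (suc ∘ edgeLabel ∘ (length pathEdges +_) ∘ (length pendantEdges +_)))
          ≡⟨ cong (incidenceSum x pathEdges (suc ∘ pathLabel) +_) (cong₂ _+_
               (incidenceSum-cong x pendantEdges λ {i} i<l →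
                  cong suc (trans (afterPath i) (⟨⟩++-< pendantLabel _ (subst (_ <_) length-pendantEdges i<l))))
               (incidenceSum-cong x joinEdges λ {i} _ →
                  cong suc (trans (afterPath (length pendantEdges + i))
                    (trans (cong (pendantLabel ⟨ n ⟩++ uLabel ⟨ n ⟩++ vLabel) (cong (_+ i) length-pendantEdges))
                           (⟨⟩++-+ pendantLabel _ n i))))) ⟩
        incidenceSum x pathEdges (suc ∘ pathLabel) +
        (incidenceSum x pendantEdges (suc ∘ pendantLabel) + incidenceSum x joinEdges (suc ∘ (uLabel ⟨ n ⟩++ vLabel)))
          ∎
        where
        open ≡-Reasoning
        afterPath : ∀ i → edgeLabel (length pathEdges + i) ≡ (pendantLabel ⟨ n ⟩++ uLabel ⟨ n ⟩++ vLabel) i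
        afterPath i = trans (cong edgeLabel (cong (_+ i) length-pathEdges)) (⟨⟩++-+ pathLabel _ (n ∸ 1) i)

      weight-u : ∀ {i} → i < n → weight (firecrackerJoinK1 n) labeling i ≡ suc (pendantLabel i) + suc (uLabel i)
      weight-u {i} i<n = trans (weight-decomposition i) (cong₂ _+_ path (cong₂ _+_ pendant join))
        where
        path : incidenceSum i pathEdges (suc ∘ pathLabel) ≡ 0
        path = trans (cong (λ es → incidenceSum i es (suc ∘ pathLabel)) pathEdges≡)
          (incidenceSum-none i _ (n ∸ 1) (suc ∘ pathLabel) λ {l} _ → incident-≢ (<⇒≢n+ l i<n) (<⇒≢n+ (suc l) i<n))
        pendant : incidenceSum i pendantEdges (suc ∘ pendantLabel) ≡ suc (pendantLabel i)
        pendant = trans (cong (λ es → incidenceSum i es (suc ∘ pendantLabel)) pendantEdges≡)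
          (incidenceSum-one i _ n (suc ∘ pendantLabel) i<n (incident-fst i (n + i))
            λ {l} _ l≢i → incident-≢ (l≢i ∘ sym) (<⇒≢n+ l i<n))
        join : incidenceSum i joinEdges (suc ∘ (uLabel ⟨ n ⟩++ vLabel)) ≡ suc (uLabel i)
        join = trans (cong (λ es → incidenceSum i es (suc ∘ (uLabel ⟨ n ⟩++ vLabel))) joinEdges≡)
          (trans (incidenceSum-one i _ (2 * n) _ (<-≤-trans i<n n≤2n) (incident-fst i (2 * n))
                   λ {l} _ l≢i → incident-≢ (l≢i ∘ sym) (<⇒≢ (<-≤-trans i<n n≤2n)))
                 (cong suc (⟨⟩++-< uLabel vLabel i<n)))

      weight-v : ∀ {i} → i < n → weight (firecrackerJoinK1 n) labeling (n + i) ≡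
        incidenceSum (n + i) pathEdges (suc ∘ pathLabel) + (suc (pendantLabel i) + suc (vLabel i))
      weight-v {i} i<n =
        trans (weight-decomposition (n + i)) (cong (incidenceSum (n + i) pathEdges (suc ∘ pathLabel) +_) (cong₂ _+_ pendant join))
        where
        pendant : incidenceSum (n + i) pendantEdges (suc ∘ pendantLabel) ≡ suc (pendantLabel i)
        pendant = trans (cong (λ es → incidenceSum (n + i) es (suc ∘ pendantLabel)) pendantEdges≡)
          (incidenceSum-one (n + i) _ n (suc ∘ pendantLabel) i<n (incident-snd i (n + i))
            λ {l} l<n l≢i → incident-≢ (<⇒≢n+ i l<n ∘ sym) (n+i≢ (l≢i ∘ sym)))
        join : incidenceSum (n + i) joinEdges (suc ∘ (uLabel ⟨ n ⟩++ vLabel)) ≡ suc (vLabel i)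
        join = trans (cong (λ es → incidenceSum (n + i) es (suc ∘ (uLabel ⟨ n ⟩++ vLabel))) joinEdges≡)
          (trans (incidenceSum-one (n + i) _ (2 * n) _ (n+<2n i<n) (incident-fst (n + i) (2 * n))
                   λ {l} _ l≢n+i → incident-≢ (l≢n+i ∘ sym) (<⇒≢ (n+<2n i<n)))
                 (cong suc (⟨⟩++-+ uLabel vLabel n i)))

      weight-w-≥ : ∀ {c} → (∀ i → c ≤ uLabel i) → (∀ i → c ≤ vLabel i) →
        2 * n * suc c ≤ weight (firecrackerJoinK1 n) labeling (2 * n)
      weight-w-≥ {c} c≤u c≤v = begin
        2 * n * suc c
          ≤⟨ sum-applyUpTo-≥ (suc ∘ (uLabel ⟨ n ⟩++ vLabel)) (2 * n) (λ _ → s≤s (⟨⟩++-≥ n c≤u c≤v _)) ⟩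
        sum (applyUpTo (suc ∘ (uLabel ⟨ n ⟩++ vLabel)) (2 * n))
          ≡⟨ join ⟨
        incidenceSum (2 * n) joinEdges (suc ∘ (uLabel ⟨ n ⟩++ vLabel))
          ≡⟨ cong₂ _+_ path (cong₂ _+_ pendant refl) ⟨
        incidenceSum (2 * n) pathEdges (suc ∘ pathLabel) +
        (incidenceSum (2 * n) pendantEdges (suc ∘ pendantLabel) + incidenceSum (2 * n) joinEdges (suc ∘ (uLabel ⟨ n ⟩++ vLabel)))
          ≡⟨ weight-decomposition (2 * n) ⟨
        weight (firecrackerJoinK1 n) labeling (2 * n)
          ∎
        where
        open ≤-Reasoning
        path : incidenceSum (2 * n) pathEdges (suc ∘ pathLabel) ≡ 0
        path = trans (cong (λ es → incidenceSum (2 * n) es (suc ∘ pathLabel)) pathEdges≡)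
          (incidenceSum-none (2 * n) _ (n ∸ 1) (suc ∘ pathLabel) λ {l} l<k →
            incident-≢ (<⇒≢ (n+<2n (<-trans (n<1+n l) (m<n∸1⇒1+m<n l<k))) ∘ sym)
                       (<⇒≢ (n+<2n (m<n∸1⇒1+m<n l<k)) ∘ sym))
        pendant : incidenceSum (2 * n) pendantEdges (suc ∘ pendantLabel) ≡ 0
        pendant = trans (cong (λ es → incidenceSum (2 * n) es (suc ∘ pendantLabel)) pendantEdges≡)
          (incidenceSum-none (2 * n) _ n (suc ∘ pendantLabel) λ {l} l<n →
            incident-≢ (<⇒≢ (<-≤-trans l<n n≤2n) ∘ sym) (<⇒≢ (n+<2n l<n) ∘ sym))
        join : incidenceSum (2 * n) joinEdges (suc ∘ (uLabel ⟨ n ⟩++ vLabel)) ≡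
               sum (applyUpTo (suc ∘ (uLabel ⟨ n ⟩++ vLabel)) (2 * n))
        join = trans (cong (λ es → incidenceSum (2 * n) es (suc ∘ (uLabel ⟨ n ⟩++ vLabel))) joinEdges≡)
          (incidenceSum-all (2 * n) _ (2 * n) _ λ {l} _ → incident-snd l (2 * n))

colour : ℕ → ℕ → ℕ → ℕ
colour X Y = interleave (λ _ → X) (λ _ → Y)

colour-≢ : ∀ {X Y} → X ≢ Y → ∀ i → colour X Y i ≢ colour Y X i
colour-≢ X≢Y zero    = X≢Y
colour-≢ X≢Y (suc i) = colour-≢ (X≢Y ∘ sym) i

colour-∈ : ∀ X Y i → colour X Y i ≡ X ⊎ colour X Y i ≡ Y
colour-∈ X Y zero    = inj₁ refl
colour-∈ X Y (suc i) = Sum.swap (colour-∈ Y X i)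

colour-shift : ∀ X Y k j → colour X Y (k + k + j) ≡ colour X Y j
colour-shift X Y = interleave-shift (λ _ → X) (λ _ → Y)

module _ {n} (2≤n : 2 ≤ n) where

  private
    1<n : 1 < n
    1<n = 2≤n
    0<n : 0 < n
    0<n = <-trans (s≤s z≤n) 1<n
    join∈ : ∀ {x} → x < 2 * n → (x , 2 * n) ∈ edges (firecrackerJoinK1 n)
    join∈ x<2n = ∈-++⁺ʳ (pathEdges n) (∈-++⁺ʳ (pendantEdges n) (∈-map⁺ (λ x → (x , 2 * n)) (∈-upTo⁺ x<2n)))

  firecrackerJoinK1-3≤numWeights : ∀ f → IsLocalAntimagic (firecrackerJoinK1 n) f → 3 ≤ numWeights (firecrackerJoinK1 n) f
  firecrackerJoinK1-3≤numWeights f antimagic =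
    3≤numWeights (firecrackerJoinK1 n) f (m<n⇒m<1+n (n+<2n n 0<n)) (m<n⇒m<1+n (n+<2n n 1<n)) ≤-refl
      (differ (∈-++⁺ˡ (∈-map⁺ (λ i → (n + i , n + suc i)) (∈-upTo⁺ (∸-monoˡ-< 2≤n (s≤s z≤n))))))
      (differ (join∈ (n+<2n n 0<n)))
      (differ (join∈ (n+<2n n 1<n)))
    where
    differ : AdjacentWeightsDiffer (firecrackerJoinK1 n) f
    differ = adjacentWeightsDiffer (firecrackerJoinK1 n) f antimagic

  χla≡3-alternating : ∀ (f : Labeling (firecrackerJoinK1 n)) {X Y} → Bijective _≡_ _≡_ f → X ≢ Y →
    (∀ {i} → i < n → weight (firecrackerJoinK1 n) f i ≡ colour X Y i) →
    (∀ {i} → i < n → weight (firecrackerJoinK1 n) f (n + i) ≡ colour Y X i) →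
    X ≢ weight (firecrackerJoinK1 n) f (2 * n) → Y ≢ weight (firecrackerJoinK1 n) f (2 * n) →
    ChiLa≡ (firecrackerJoinK1 n) 3
  χla≡3-alternating f {X} {Y} bijective X≢Y weight-u weight-v X≢W Y≢W =
    (f , isLocalAntimagic (firecrackerJoinK1 n) f bijective differ ,
         numWeights≡3 (firecrackerJoinK1 n) f (vertex 0<n) (vertex 1<n) ≤-refl
           (λ eq → X≢Y (trans (sym (weight-u 0<n)) (trans eq (weight-u 1<n))))
           (λ eq → X≢W (trans (sym (weight-u 0<n)) eq))
           (λ eq → Y≢W (trans (sym (weight-u 1<n)) eq))
           three) ,
    firecrackerJoinK1-3≤numWeights
    where
    vertex : ∀ {i} → i < n → i < suc (2 * n)
    vertex i<n = m<n⇒m<1+n (<-≤-trans i<n (n≤2n n))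
    X-or-Y : ∀ {x} → x < 2 * n → weight (firecrackerJoinK1 n) f x ≡ X ⊎ weight (firecrackerJoinK1 n) f x ≡ Y
    X-or-Y {x} x<2n with x <? n
    ... | yes x<n = Sum.map (trans (weight-u x<n)) (trans (weight-u x<n)) (colour-∈ X Y x)
    ... | no x≮n with i , refl ← m≤n⇒∃[o]m+o≡n (≮⇒≥ x≮n) =
      let i<n = +-cancelˡ-< n i n (subst (n + i <_) (2n≡n+n n) x<2n) in
      Sum.swap (Sum.map (trans (weight-v i<n)) (trans (weight-v i<n)) (colour-∈ Y X i))
    three : ∀ {v} → v < nV (firecrackerJoinK1 n) → weight (firecrackerJoinK1 n) f v ∈
      (weight (firecrackerJoinK1 n) f 0 ∷ weight (firecrackerJoinK1 n) f 1 ∷ weight (firecrackerJoinK1 n) f (2 * n) ∷ [])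
    three {v} v<2n+1 with v <? 2 * n
    ... | yes v<2n = Sum.[ (λ eq → here (trans eq (sym (weight-u 0<n))))
                         , (λ eq → there (here (trans eq (sym (weight-u 1<n))))) ] (X-or-Y v<2n)
    ... | no v≮2n with refl ← ≤-antisym (≤-pred v<2n+1) (≮⇒≥ v≮2n) = there (there (here refl))
    differ : AdjacentWeightsDiffer (firecrackerJoinK1 n) f
    differ ab∈ with ∈-++⁻ (pathEdges n) ab∈
    ... | inj₁ path∈ with i , i∈ , refl ← ∈-map⁻ _ path∈ =
      let i+1<n = m<n∸1⇒1+m<n (∈-upTo⁻ i∈) in
      λ eq → colour-≢ X≢Y i (sym (trans (sym (weight-v (<-trans (n<1+n i) i+1<n))) (trans eq (weight-v i+1<n))))
    ... | inj₂ rest∈ with ∈-++⁻ (pendantEdges n) rest∈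
    ...   | inj₁ pendant∈ with i , i∈ , refl ← ∈-map⁻ _ pendant∈ =
      λ eq → colour-≢ X≢Y i (trans (sym (weight-u (∈-upTo⁻ i∈))) (trans eq (weight-v (∈-upTo⁻ i∈))))
    ...   | inj₂ join∈′ with x , x∈ , refl ← ∈-map⁻ _ join∈′ =
      Sum.[ (λ eq eq′ → X≢W (trans (sym eq) eq′)) , (λ eq eq′ → Y≢W (trans (sym eq) eq′)) ] (X-or-Y (∈-upTo⁻ x∈))

-- Zigzag labelling of the path

zigzag : ℕ → ℕ → ℕ
zigzag k = interleave (λ j → k ∸ suc j) id

zigzag↭upTo : ∀ k → applyUpTo (zigzag k) k ↭ upTo k
zigzag↭upTo k = begin
  applyUpTo (zigzag k) k                                  ↭⟨ applyUpTo-interleave (λ j → k ∸ suc j) id k ⟩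
  applyUpTo (λ j → k ∸ suc j) ⌈ k /2⌉ ++ upTo ⌊ k /2⌋     ≡⟨ cong (_++ upTo ⌊ k /2⌋) (applyUpTo-cong ⌈ k /2⌉ split) ⟩
  applyUpTo (λ j → ⌊ k /2⌋ + (⌈ k /2⌉ ∸ suc j)) ⌈ k /2⌉ ++ upTo ⌊ k /2⌋
                                                          ↭⟨ ++⁺ (applyUpTo-reflect (⌊ k /2⌋ +_) ⌈ k /2⌉) ↭-refl ⟩
  range ⌊ k /2⌋ ⌈ k /2⌉ ++ range 0 ⌊ k /2⌋                ↭⟨ ++-comm (range ⌊ k /2⌋ ⌈ k /2⌉) (range 0 ⌊ k /2⌋) ⟩
  range 0 ⌊ k /2⌋ ++ range ⌊ k /2⌋ ⌈ k /2⌉                ≡⟨ range-++ ⌊ k /2⌋ ⌈ k /2⌉ refl ⟩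
  range 0 (⌊ k /2⌋ + ⌈ k /2⌉)                             ≡⟨ cong (range 0) (⌊n/2⌋+⌈n/2⌉≡n k) ⟩
  upTo k                                                  ∎
  where
  open PermutationReasoning
  split : ∀ {j} → j < ⌈ k /2⌉ → k ∸ suc j ≡ ⌊ k /2⌋ + (⌈ k /2⌉ ∸ suc j)
  split {j} j<e = trans (cong (_∸ suc j) (sym (⌊n/2⌋+⌈n/2⌉≡n k))) (+-∸-assoc ⌊ k /2⌋ j<e)

incidenceSum-zigzag : ∀ n {i} → i < n ∸ 1 → incidenceSum (n + i) (pathEdges n) (suc ∘ zigzag (n ∸ 1)) ≡ colour (n ∸ 1) n i
incidenceSum-zigzag n {zero} 0<k =
  trans (incidenceSum-path-first n (suc ∘ zigzag (n ∸ 1)) 0<k) (suc-pred (n ∸ 1) {{>-nonZero 0<k}})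
incidenceSum-zigzag n {suc j} j+1<k with parity j
... | even t = begin
  incidenceSum (n + suc (t + t)) (pathEdges n) g  ≡⟨ incidenceSum-path-inner n g j+1<k ⟩
  g (t + t) + g (suc (t + t))
    ≡⟨ cong₂ (λ a b → suc a + suc b) (interleave-even (λ j → n ∸ 1 ∸ suc j) id t) (interleave-odd (λ j → n ∸ 1 ∸ suc j) id t) ⟩
  suc ((n ∸ 1 ∸ suc t) + suc t)                   ≡⟨ cong suc (m∸n+n≡m (≤-trans (s≤s (m≤m+n t t)) (<⇒≤ j+1<k))) ⟩
  suc (n ∸ 1)                                     ≡⟨ suc-pred n {{>-nonZero 0<n}} ⟩
  n                                               ≡⟨ interleave-odd (λ _ → n ∸ 1) (λ _ → n) t ⟨
  colour (n ∸ 1) n (suc (t + t))                  ∎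
  where
  open ≡-Reasoning
  g : ℕ → ℕ
  g = suc ∘ zigzag (n ∸ 1)
  0<n : 0 < n
  0<n = <-≤-trans (<-trans (s≤s z≤n) j+1<k) (m∸n≤m n 1)
... | odd t = begin
  incidenceSum (n + suc (suc (t + t))) (pathEdges n) g ≡⟨ incidenceSum-path-inner n g j+1<k ⟩
  g (suc (t + t)) + g (suc (suc (t + t)))
    ≡⟨ cong₂ _+_ (cong suc (interleave-odd (λ j → n ∸ 1 ∸ suc j) id t)) (cong (g ∘ suc) (sym (+-suc t t))) ⟩
  suc t + g (suc t + suc t)
    ≡⟨ cong (λ x → suc t + suc x) (interleave-even (λ j → n ∸ 1 ∸ suc j) id (suc t)) ⟩
  suc t + suc (n ∸ 1 ∸ suc (suc t))                    ≡⟨ swap-sucs t (n ∸ 1 ∸ suc (suc t)) ⟩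
  (n ∸ 1 ∸ suc (suc t)) + suc (suc t)                  ≡⟨ m∸n+n≡m (≤-trans (s≤s (s≤s (m≤m+n t t))) (<⇒≤ j+1<k)) ⟩
  n ∸ 1                                                ≡⟨ interleave-even (λ _ → n ∸ 1) (λ _ → n) (suc t) ⟨
  colour (n ∸ 1) n (suc t + suc t)                     ≡⟨ cong (colour (n ∸ 1) n) (+-suc (suc t) t) ⟩
  colour (n ∸ 1) n (suc (suc (t + t)))                 ∎
  where
  open ≡-Reasoning
  g : ℕ → ℕ
  g = suc ∘ zigzag (n ∸ 1)
  swap-sucs : ∀ t x → suc t + suc x ≡ x + suc (suc t)
  swap-sucs t x = solve (t ∷ x ∷ [])

zigzag-last : ∀ k → 0 < k → suc (zigzag k (pred k)) ≡ ⌈ k /2⌉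
zigzag-last k 0<k with parity k
zigzag-last .(suc t + suc t) _ | even (suc t) = begin
  suc (zigzag (suc t + suc t) (t + suc t))     ≡⟨ cong (suc ∘ zigzag (suc t + suc t)) (+-suc t t) ⟩
  suc (zigzag (suc t + suc t) (suc (t + t)))   ≡⟨ cong suc (interleave-odd (λ j → suc t + suc t ∸ suc j) id t) ⟩
  suc t                                        ≡⟨ n≡⌈n+n/2⌉ (suc t) ⟩
  ⌈ suc t + suc t /2⌉                          ∎
  where open ≡-Reasoning
zigzag-last .(suc (t + t)) _ | odd t = begin
  suc (zigzag (suc (t + t)) (t + t))           ≡⟨ cong suc (interleave-even (λ j → suc (t + t) ∸ suc j) id t) ⟩
  suc (t + t ∸ t)                              ≡⟨ cong suc (m+n∸m≡n t t) ⟩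
  suc t                                        ≡⟨ cong suc (n≡⌊n+n/2⌋ t) ⟩
  ⌈ suc (t + t) /2⌉                            ∎
  where open ≡-Reasoning

-- Odd n

odd-weight-bound : ∀ h → 1 ≤ h → 12 * h + 5 < 2 * suc (h + h) * suc (2 * h)
odd-weight-bound (suc t) _ = subst (suc (12 * suc t + 5) ≤_) expand (m≤m+n (suc (12 * suc t + 5)) (8 * t * t + 12 * t))
  where
  expand : suc (12 * suc t + 5) + (8 * t * t + 12 * t) ≡ 2 * suc (suc t + suc t) * suc (2 * suc t)
  expand = solve (t ∷ [])


module OddCase (h : ℕ) where

  qEven qOdd vEven : ℕ → ℕ
  qEven k = 6 * h + 2 + (suc h ∸ suc k)
  qOdd  k = 7 * h + 3 + (h ∸ suc k)
  vEven   = (3 * h +_) ⟨ h ⟩++ λ _ → 5 * h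

  pendantLabel uLabel vLabel : ℕ → ℕ
  pendantLabel = interleave qEven qOdd
  uLabel       = interleave (5 * h + 1 +_) (4 * h +_)
  vLabel       = interleave vEven (2 * h +_)

  open EdgeLabels (suc (h + h)) (zigzag (h + h)) pendantLabel uLabel vLabel

  labels↭ : labels ↭ upTo ((h + h) + (suc (h + h) + (suc (h + h) + suc (h + h))))
  labels↭ = begin
    labels
      ↭⟨ ++⁺ (zigzag↭upTo (h + h)) (++⁺ pendant↭ (++⁺ (applyUpTo-interleave-1+n+n (5 * h + 1 +_) (4 * h +_) h) v↭)) ⟩
    P ++ (qe ++ qo) ++ (ue ++ uo) ++ (ve ++ b*) ++ vo
      ↭⟨ rearrange 8 (λ P qe qo ue uo ve b* vo → P ⊕ (qe ⊕ qo) ⊕ (ue ⊕ uo) ⊕ (ve ⊕ b*) ⊕ vo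
                                                 ⊜ P ⊕ vo ⊕ ve ⊕ uo ⊕ b* ⊕ ue ⊕ qe ⊕ qo) ↭-refl P qe qo ue uo ve b* vo ⟩
    P ++ vo ++ ve ++ uo ++ b* ++ ue ++ qe ++ qo
      ≡⟨ intervals-consecutive tiling ⟩
    range 0 (h + h + (h + (h + (h + (1 + (suc h + (suc h + (h + 0))))))))
      ≡⟨ cong upTo (solve (h ∷ [])) ⟩
    upTo ((h + h) + (suc (h + h) + (suc (h + h) + suc (h + h))))
      ∎
    where
    open PermutationReasoning
    P qe qo ue uo ve b* vo : List ℕ
    P  = upTo (h + h)
    qe = range (6 * h + 2) (suc h)
    qo = range (7 * h + 3) h
    ue = range (5 * h + 1) (suc h)
    uo = range (4 * h) h
    ve = range (3 * h) h
    b* = range (5 * h) 1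
    vo = range (2 * h) h
    pendant↭ : applyUpTo pendantLabel (suc (h + h)) ↭ qe ++ qo
    pendant↭ = ↭-trans (applyUpTo-interleave-1+n+n qEven qOdd h)
                       (++⁺ (applyUpTo-reflect (6 * h + 2 +_) (suc h)) (applyUpTo-reflect (7 * h + 3 +_) h))
    v↭ : applyUpTo vLabel (suc (h + h)) ↭ (ve ++ b*) ++ vo
    v↭ = ↭-trans (applyUpTo-interleave-1+n+n vEven (2 * h +_) h) (++⁺ (↭-reflexive even-part) ↭-refl)
      where
      even-part : applyUpTo vEven (suc h) ≡ ve ++ b*
      even-part = trans (cong (applyUpTo vEven) (+-comm 1 h)) (trans (applyUpTo-⟨⟩++ (3 * h +_) (λ _ → 5 * h) h 1)
                        (cong (λ x → ve ++ x ∷ []) (sym (+-identityʳ (5 * h)))))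
    tiling : Consecutive ((0 , h + h) ∷ (2 * h , h) ∷ (3 * h , h) ∷ (4 * h , h) ∷ (5 * h , 1) ∷
                          (5 * h + 1 , suc h) ∷ (6 * h + 2 , suc h) ∷ (7 * h + 3 , h) ∷ [])
    tiling = solve (h ∷ []) ∷ solve (h ∷ []) ∷ solve (h ∷ []) ∷ solve (h ∷ []) ∷
             solve (h ∷ []) ∷ solve (h ∷ []) ∷ solve (h ∷ []) ∷ last

  open Permuted labels↭

  private
    half-≤ : ∀ {k} → k + k < suc (h + h) → k ≤ h
    half-≤ {k} k+k<n = ≮⇒≥ λ h<k → <⇒≱ k+k<n (≤-trans (s≤s (+-monoʳ-≤ h (n≤1+n h))) (+-mono-≤ h<k h<k))

    half-< : ∀ {k} → suc (k + k) < suc (h + h) → k < h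
    half-< {k} k+k<n = ≰⇒> λ h≤k → <⇒≱ (≤-pred k+k<n) (+-mono-≤ h≤k h≤k)

  X Y : ℕ
  X = 12 * h + 5
  Y = 12 * h + 4

  u-colour : ∀ {i} → i < suc (h + h) → suc (pendantLabel i) + suc (uLabel i) ≡ colour X Y i
  u-colour {i} i<n with parity i
  ... | even k = begin
    suc (pendantLabel (k + k)) + suc (uLabel (k + k))
      ≡⟨ cong₂ (λ a b → suc a + suc b) (interleave-even qEven qOdd k) (interleave-even (5 * h + 1 +_) (4 * h +_) k) ⟩
    suc (6 * h + 2 + (h ∸ k)) + suc (5 * h + 1 + k) ≡⟨ rearrange-∸ (h ∸ k) ⟩
    11 * h + 5 + ((h ∸ k) + k)                      ≡⟨ cong (11 * h + 5 +_) (m∸n+n≡m (half-≤ {k} i<n)) ⟩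
    11 * h + 5 + h                                  ≡⟨ solve (h ∷ []) ⟩
    12 * h + 5                                      ≡⟨ interleave-even (λ _ → X) (λ _ → Y) k ⟨
    colour X Y (k + k)                              ∎
    where
    open ≡-Reasoning
    rearrange-∸ : ∀ d → suc (6 * h + 2 + d) + suc (5 * h + 1 + k) ≡ 11 * h + 5 + (d + k)
    rearrange-∸ d = solve (h ∷ k ∷ d ∷ [])
  ... | odd k = begin
    suc (pendantLabel (suc (k + k))) + suc (uLabel (suc (k + k)))
      ≡⟨ cong₂ (λ a b → suc a + suc b) (interleave-odd qEven qOdd k) (interleave-odd (5 * h + 1 +_) (4 * h +_) k) ⟩
    suc (7 * h + 3 + (h ∸ suc k)) + suc (4 * h + k) ≡⟨ rearrange-∸ (h ∸ suc k) ⟩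
    11 * h + 4 + ((h ∸ suc k) + suc k)              ≡⟨ cong (11 * h + 4 +_) (m∸n+n≡m (half-< {k} i<n)) ⟩
    11 * h + 4 + h                                  ≡⟨ solve (h ∷ []) ⟩
    12 * h + 4                                      ≡⟨ interleave-odd (λ _ → X) (λ _ → Y) k ⟨
    colour X Y (suc (k + k))                        ∎
    where
    open ≡-Reasoning
    rearrange-∸ : ∀ d → suc (7 * h + 3 + d) + suc (4 * h + k) ≡ 11 * h + 4 + (d + suc k)
    rearrange-∸ d = solve (h ∷ k ∷ d ∷ [])

  v-colour-inner : ∀ {i} → i < h + h → colour (h + h) (suc (h + h)) i + (suc (pendantLabel i) + suc (vLabel i)) ≡ colour Y X i
  v-colour-inner {i} i<2h with parity i
  ... | even k = begin
    colour (h + h) (suc (h + h)) (k + k) + (suc (pendantLabel (k + k)) + suc (vLabel (k + k)))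
      ≡⟨ cong₂ (λ a b → a + (suc (pendantLabel (k + k)) + suc b)) (interleave-even (λ _ → h + h) (λ _ → suc (h + h)) k)
           (trans (interleave-even vEven (2 * h +_) k) (⟨⟩++-< (3 * h +_) (λ _ → 5 * h) k<h)) ⟩
    h + h + (suc (pendantLabel (k + k)) + suc (3 * h + k))
      ≡⟨ cong (λ a → h + h + (suc a + suc (3 * h + k))) (interleave-even qEven qOdd k) ⟩
    h + h + (suc (6 * h + 2 + (h ∸ k)) + suc (3 * h + k)) ≡⟨ rearrange-∸ (h ∸ k) ⟩
    11 * h + 4 + ((h ∸ k) + k)                            ≡⟨ cong (11 * h + 4 +_) (m∸n+n≡m (<⇒≤ k<h)) ⟩
    11 * h + 4 + h                                        ≡⟨ solve (h ∷ []) ⟩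
    12 * h + 4                                            ≡⟨ interleave-even (λ _ → Y) (λ _ → X) k ⟨
    colour Y X (k + k)                                    ∎
    where
    open ≡-Reasoning
    k<h : k < h
    k<h = ≰⇒> λ h≤k → <⇒≱ i<2h (+-mono-≤ h≤k h≤k)
    rearrange-∸ : ∀ d → h + h + (suc (6 * h + 2 + d) + suc (3 * h + k)) ≡ 11 * h + 4 + (d + k)
    rearrange-∸ d = solve (h ∷ k ∷ d ∷ [])
  ... | odd k = begin
    colour (h + h) (suc (h + h)) (suc (k + k)) + (suc (pendantLabel (suc (k + k))) + suc (vLabel (suc (k + k))))
      ≡⟨ cong₂ _+_ (interleave-odd (λ _ → h + h) (λ _ → suc (h + h)) k)
           (cong₂ (λ a b → suc a + suc b) (interleave-odd qEven qOdd k) (interleave-odd vEven (2 * h +_) k)) ⟩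
    suc (h + h) + (suc (7 * h + 3 + (h ∸ suc k)) + suc (2 * h + k)) ≡⟨ rearrange-∸ (h ∸ suc k) ⟩
    11 * h + 5 + ((h ∸ suc k) + suc k)                              ≡⟨ cong (11 * h + 5 +_) (m∸n+n≡m k<h) ⟩
    11 * h + 5 + h                                                  ≡⟨ solve (h ∷ []) ⟩
    12 * h + 5                                                      ≡⟨ interleave-odd (λ _ → Y) (λ _ → X) k ⟨
    colour Y X (suc (k + k))                                        ∎
    where
    open ≡-Reasoning
    k<h : k < h
    k<h = ≰⇒> λ h≤k → <⇒≱ (<-trans (n<1+n _) i<2h) (+-mono-≤ h≤k h≤k)
    rearrange-∸ : ∀ d → suc (h + h) + (suc (7 * h + 3 + d) + suc (2 * h + k)) ≡ 11 * h + 5 + (d + suc k)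
    rearrange-∸ d = solve (h ∷ k ∷ d ∷ [])

  v-colour-last : h + (suc (pendantLabel (h + h)) + suc (vLabel (h + h))) ≡ colour Y X (h + h)
  v-colour-last = begin
    h + (suc (pendantLabel (h + h)) + suc (vLabel (h + h)))
      ≡⟨ cong (h +_) (cong₂ (λ a b → suc a + suc b) (trans (interleave-even qEven qOdd h) (cong (6 * h + 2 +_) (n∸n≡0 h)))
                       (trans (interleave-even vEven (2 * h +_) h) (⟨⟩++-≡ (3 * h +_) (λ _ → 5 * h) h))) ⟩
    h + (suc (6 * h + 2 + 0) + suc (5 * h)) ≡⟨ solve (h ∷ []) ⟩
    12 * h + 4                              ≡⟨ interleave-even (λ _ → Y) (λ _ → X) h ⟨
    colour Y X (h + h)                      ∎
    where open ≡-Reasoning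

  v-colour : 1 ≤ h → ∀ {i} → i < suc (h + h) →
    incidenceSum (suc (h + h) + i) (pathEdges (suc (h + h))) (suc ∘ zigzag (h + h)) + (suc (pendantLabel i) + suc (vLabel i))
      ≡ colour Y X i
  v-colour 1≤h {i} i<n with i <? h + h
  ... | yes i<2h = trans (cong (_+ (suc (pendantLabel i) + suc (vLabel i))) (incidenceSum-zigzag (suc (h + h)) i<2h))
                         (v-colour-inner i<2h)
  ... | no i≮2h with refl ← ≤-antisym (≤-pred i<n) (≮⇒≥ i≮2h) =
    trans (cong (_+ (suc (pendantLabel (h + h)) + suc (vLabel (h + h))))
                (trans (incidenceSum-path-last (suc (h + h)) (suc ∘ zigzag (h + h)) 0<2h)
                       (trans (zigzag-last (h + h) 0<2h) (sym (n≡⌈n+n/2⌉ h)))))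
          v-colour-last
    where
    0<2h : 0 < h + h
    0<2h = <-≤-trans 1≤h (m≤m+n h h)

  χla≡3-odd : 1 ≤ h → ChiLa≡ (firecrackerJoinK1 (suc (h + h))) 3
  χla≡3-odd 1≤h = χla≡3-alternating (s≤s (<-≤-trans 1≤h (m≤m+n h h))) labeling labeling-bijective (<⇒≢ Y<X ∘ sym)
    (λ i<n → trans (weight-u i<n) (u-colour i<n))
    (λ i<n → trans (weight-v i<n) (v-colour 1≤h i<n))
    (<⇒≢ X<W) (<⇒≢ (<-trans Y<X X<W))
    where
    Y<X : Y < X
    Y<X = +-monoʳ-< (12 * h) ≤-refl
    X<W : X < weight (firecrackerJoinK1 (suc (h + h))) labeling (2 * suc (h + h))
    X<W = <-≤-trans (odd-weight-bound h 1≤h) (weight-w-≥ 2h≤u 2h≤v)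
      where
      2h≤ : ∀ c → 2 * h ≤ (2 + c) * h
      2h≤ c = *-monoˡ-≤ h (m≤m+n 2 c)
      2h≤u : ∀ i → 2 * h ≤ uLabel i
      2h≤u = interleave-≥ (λ k → ≤-trans (2h≤ 3) (≤-trans (m≤m+n (5 * h) 1) (m≤m+n (5 * h + 1) k)))
                          (λ k → ≤-trans (2h≤ 2) (m≤m+n (4 * h) k))
      2h≤v : ∀ i → 2 * h ≤ vLabel i
      2h≤v = interleave-≥ (⟨⟩++-≥ h (λ k → ≤-trans (2h≤ 1) (m≤m+n (3 * h) k)) (λ _ → 2h≤ 3))
                          (λ k → m≤m+n (2 * h) k)

-- Even n

module EvenCase (r : ℕ) where

  qTail uTail vTail : ℕ → ℕ
  qTail 0 = 4 * r + 8
  qTail 1 = 6 * r + 12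
  qTail 2 = 6 * r + 10
  qTail _ = 2 * r + 4
  uTail 0 = 6 * r + 11
  uTail 1 = 4 * r + 6
  uTail 2 = 4 * r + 9
  uTail _ = 8 * r + 14
  vTail 0 = 4 * r + 7
  vTail 1 = 2 * r + 3
  vTail 2 = 2 * r + 5
  vTail _ = 7 * r + 13

  uEven uOdd vEven vOdd : ℕ → ℕ
  uEven k = 7 * r + 14 + (r ∸ suc k)
  uOdd  k = 6 * r + 13 + (r ∸ suc k)
  vEven k = 5 * r + 10 + (r ∸ suc k)
  vOdd  k = 4 * r + 10 + (r ∸ suc k)

  qRegular uRegular vRegular : ℕ → ℕ
  qRegular = interleave (2 * r + 6 +_) (3 * r + 6 +_)
  uRegular = interleave uEven uOdd
  vRegular = interleave vEven vOdd

  pendantLabel uLabel vLabel : ℕ → ℕ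
  pendantLabel = qRegular ⟨ r + r ⟩++ qTail
  uLabel       = uRegular ⟨ r + r ⟩++ uTail
  vLabel       = vRegular ⟨ r + r ⟩++ vTail

  n≡ : suc (suc r) + suc (suc r) ≡ r + r + 4
  n≡ = solve (r ∷ [])

  open EdgeLabels (suc (suc r) + suc (suc r)) (zigzag (suc r + suc (suc r))) pendantLabel uLabel vLabel

  labels↭ : labels ↭
    upTo ((suc r + suc (suc r)) + ((suc (suc r) + suc (suc r)) + ((suc (suc r) + suc (suc r)) + (suc (suc r) + suc (suc r)))))
  labels↭ = begin
    labels
      ↭⟨ ++⁺ (zigzag↭upTo (suc r + suc (suc r))) (++⁺ pendant↭ (++⁺ u↭ v↭)) ⟩
    P ++ (qe ++ qo ++ q₀ ++ q₁ ++ q₂ ++ q₃) ++ (ue ++ uo ++ u₀ ++ u₁ ++ u₂ ++ u₃) ++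
         (ve ++ vo ++ v₀ ++ v₁ ++ v₂ ++ v₃)
      ↭⟨ rearrange 19 (λ P qe qo q₀ q₁ q₂ q₃ ue uo u₀ u₁ u₂ u₃ ve vo v₀ v₁ v₂ v₃ →
             P ⊕ (qe ⊕ qo ⊕ q₀ ⊕ q₁ ⊕ q₂ ⊕ q₃) ⊕ (ue ⊕ uo ⊕ u₀ ⊕ u₁ ⊕ u₂ ⊕ u₃) ⊕
                 (ve ⊕ vo ⊕ v₀ ⊕ v₁ ⊕ v₂ ⊕ v₃)
           ⊜ P ⊕ v₁ ⊕ q₃ ⊕ v₂ ⊕ qe ⊕ qo ⊕ u₁ ⊕ v₀ ⊕ q₀ ⊕ u₂ ⊕
             vo ⊕ ve ⊕ q₂ ⊕ u₀ ⊕ q₁ ⊕ uo ⊕ v₃ ⊕ ue ⊕ u₃)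
           ↭-refl P qe qo q₀ q₁ q₂ q₃ ue uo u₀ u₁ u₂ u₃ ve vo v₀ v₁ v₂ v₃ ⟩
    P ++ v₁ ++ q₃ ++ v₂ ++ qe ++ qo ++ u₁ ++ v₀ ++ q₀ ++ u₂ ++
         vo ++ ve ++ q₂ ++ u₀ ++ q₁ ++ uo ++ v₃ ++ ue ++ u₃
      ≡⟨ intervals-consecutive tiling ⟩
    range 0 (suc r + suc (suc r) +
             (1 + (1 + (1 + (r + (r + (1 + (1 + (1 + (1 + (r + (r + (1 + (1 + (1 + (r + (1 + (r + (1 + 0)))))))))))))))))))
      ≡⟨ cong upTo (solve (r ∷ [])) ⟩
    upTo ((suc r + suc (suc r)) + ((suc (suc r) + suc (suc r)) + ((suc (suc r) + suc (suc r)) + (suc (suc r) + suc (suc r)))))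
      ∎
    where
    open PermutationReasoning
    P qe qo q₀ q₁ q₂ q₃ ue uo u₀ u₁ u₂ u₃ ve vo v₀ v₁ v₂ v₃ : List ℕ
    P  = upTo (suc r + suc (suc r))
    qe = range (2 * r + 6) r
    qo = range (3 * r + 6) r
    q₀ = range (4 * r + 8) 1
    q₁ = range (6 * r + 12) 1
    q₂ = range (6 * r + 10) 1
    q₃ = range (2 * r + 4) 1
    ue = range (7 * r + 14) r
    uo = range (6 * r + 13) r
    u₀ = range (6 * r + 11) 1
    u₁ = range (4 * r + 6) 1
    u₂ = range (4 * r + 9) 1
    u₃ = range (8 * r + 14) 1
    ve = range (5 * r + 10) r
    vo = range (4 * r + 10) r
    v₀ = range (4 * r + 7) 1
    v₁ = range (2 * r + 3) 1
    v₂ = range (2 * r + 5) 1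
    v₃ = range (7 * r + 13) 1
    split : ∀ f t → applyUpTo (f ⟨ r + r ⟩++ t) (suc (suc r) + suc (suc r)) ≡
                    applyUpTo f (r + r) ++ (t 0 ∷ t 1 ∷ t 2 ∷ t 3 ∷ [])
    split f t = trans (cong (applyUpTo (f ⟨ r + r ⟩++ t)) n≡) (applyUpTo-⟨⟩++ f t (r + r) 4)
    pendant↭ : applyUpTo pendantLabel (suc (suc r) + suc (suc r)) ↭ qe ++ qo ++ q₀ ++ q₁ ++ q₂ ++ q₃
    pendant↭ = ↭-trans (↭-reflexive (split qRegular qTail))
      (↭-trans (++⁺ (applyUpTo-interleave-n+n (2 * r + 6 +_) (3 * r + 6 +_) r) (↭-reflexive (singletons _ _ _ _)))
        (↭-reflexive (++-assoc qe qo _)))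
    u↭ : applyUpTo uLabel (suc (suc r) + suc (suc r)) ↭ ue ++ uo ++ u₀ ++ u₁ ++ u₂ ++ u₃
    u↭ = ↭-trans (↭-reflexive (split uRegular uTail))
      (↭-trans (++⁺ (↭-trans (applyUpTo-interleave-n+n uEven uOdd r)
                             (++⁺ (applyUpTo-reflect (7 * r + 14 +_) r) (applyUpTo-reflect (6 * r + 13 +_) r)))
                     (↭-reflexive (singletons _ _ _ _)))
        (↭-reflexive (++-assoc ue uo _)))
    v↭ : applyUpTo vLabel (suc (suc r) + suc (suc r)) ↭ ve ++ vo ++ v₀ ++ v₁ ++ v₂ ++ v₃
    v↭ = ↭-trans (↭-reflexive (split vRegular vTail))
      (↭-trans (++⁺ (↭-trans (applyUpTo-interleave-n+n vEven vOdd r)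
                             (++⁺ (applyUpTo-reflect (5 * r + 10 +_) r) (applyUpTo-reflect (4 * r + 10 +_) r)))
                     (↭-reflexive (singletons _ _ _ _)))
        (↭-reflexive (++-assoc ve vo _)))
    tiling : Consecutive ((0 , suc r + suc (suc r)) ∷ (2 * r + 3 , 1) ∷ (2 * r + 4 , 1) ∷ (2 * r + 5 , 1) ∷ (2 * r + 6 , r) ∷
                          (3 * r + 6 , r) ∷ (4 * r + 6 , 1) ∷ (4 * r + 7 , 1) ∷ (4 * r + 8 , 1) ∷ (4 * r + 9 , 1) ∷ (4 * r + 10 , r) ∷
                          (5 * r + 10 , r) ∷ (6 * r + 10 , 1) ∷ (6 * r + 11 , 1) ∷ (6 * r + 12 , 1) ∷ (6 * r + 13 , r) ∷
                          (7 * r + 13 , 1) ∷ (7 * r + 14 , r) ∷ (8 * r + 14 , 1) ∷ [])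
    tiling = solve (r ∷ []) ∷ solve (r ∷ []) ∷ solve (r ∷ []) ∷ solve (r ∷ []) ∷ solve (r ∷ []) ∷ solve (r ∷ []) ∷
             solve (r ∷ []) ∷ solve (r ∷ []) ∷ solve (r ∷ []) ∷ solve (r ∷ []) ∷ solve (r ∷ []) ∷ solve (r ∷ []) ∷
             solve (r ∷ []) ∷ solve (r ∷ []) ∷ solve (r ∷ []) ∷ solve (r ∷ []) ∷ solve (r ∷ []) ∷ solve (r ∷ []) ∷ last

  open Permuted labels↭

  X Y : ℕ
  X = 10 * r + 21
  Y = 10 * r + 20

  half-< : ∀ {k} → k + k < r + r → k < r
  half-< {k} k+k<2r = ≰⇒> λ r≤k → <⇒≱ k+k<2r (+-mono-≤ r≤k r≤k)

  data Position : ℕ → Set where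
    regular : ∀ {i} → i < r + r → Position i
    tail    : ∀ j → j < 4 → Position (r + r + j)

  position : ∀ {i} → i < suc (suc r) + suc (suc r) → Position i
  position {i} i<n with i <? r + r
  ... | yes i<2r = regular i<2r
  ... | no i≮2r with j , refl ← m≤n⇒∃[o]m+o≡n (≮⇒≥ i≮2r) =
    tail j (+-cancelˡ-< (r + r) j 4 (subst (r + r + j <_) n≡ i<n))

  u-colour-regular : ∀ {i} → i < r + r → suc (qRegular i) + suc (uRegular i) ≡ colour X Y i
  u-colour-regular {i} i<2r with parity i
  ... | even k = begin
    suc (qRegular (k + k)) + suc (uRegular (k + k))
      ≡⟨ cong₂ (λ a b → suc a + suc b) (interleave-even (2 * r + 6 +_) (3 * r + 6 +_) k) (interleave-even uEven uOdd k) ⟩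
    suc (2 * r + 6 + k) + suc (7 * r + 14 + (r ∸ suc k)) ≡⟨ rearrange-∸ (r ∸ suc k) ⟩
    9 * r + 21 + ((r ∸ suc k) + suc k)                   ≡⟨ cong (9 * r + 21 +_) (m∸n+n≡m (half-< i<2r)) ⟩
    9 * r + 21 + r                                       ≡⟨ solve (r ∷ []) ⟩
    10 * r + 21                                          ≡⟨ interleave-even (λ _ → X) (λ _ → Y) k ⟨
    colour X Y (k + k)                                   ∎
    where
    open ≡-Reasoning
    rearrange-∸ : ∀ d → suc (2 * r + 6 + k) + suc (7 * r + 14 + d) ≡ 9 * r + 21 + (d + suc k)
    rearrange-∸ d = solve (r ∷ k ∷ d ∷ [])
  ... | odd k = begin
    suc (qRegular (suc (k + k))) + suc (uRegular (suc (k + k)))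
      ≡⟨ cong₂ (λ a b → suc a + suc b) (interleave-odd (2 * r + 6 +_) (3 * r + 6 +_) k) (interleave-odd uEven uOdd k) ⟩
    suc (3 * r + 6 + k) + suc (6 * r + 13 + (r ∸ suc k)) ≡⟨ rearrange-∸ (r ∸ suc k) ⟩
    9 * r + 20 + ((r ∸ suc k) + suc k)                   ≡⟨ cong (9 * r + 20 +_) (m∸n+n≡m (half-< (<-trans (n<1+n _) i<2r))) ⟩
    9 * r + 20 + r                                       ≡⟨ solve (r ∷ []) ⟩
    10 * r + 20                                          ≡⟨ interleave-odd (λ _ → X) (λ _ → Y) k ⟨
    colour X Y (suc (k + k))                             ∎
    where
    open ≡-Reasoning
    rearrange-∸ : ∀ d → suc (3 * r + 6 + k) + suc (6 * r + 13 + d) ≡ 9 * r + 20 + (d + suc k)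
    rearrange-∸ d = solve (r ∷ k ∷ d ∷ [])

  u-colour-tail : ∀ j → j < 4 → suc (qTail j) + suc (uTail j) ≡ colour X Y j
  u-colour-tail 0 _ = arith
    where
    arith : suc (4 * r + 8) + suc (6 * r + 11) ≡ 10 * r + 21
    arith = solve (r ∷ [])
  u-colour-tail 1 _ = arith
    where
    arith : suc (6 * r + 12) + suc (4 * r + 6) ≡ 10 * r + 20
    arith = solve (r ∷ [])
  u-colour-tail 2 _ = arith
    where
    arith : suc (6 * r + 10) + suc (4 * r + 9) ≡ 10 * r + 21
    arith = solve (r ∷ [])
  u-colour-tail 3 _ = arith
    where
    arith : suc (2 * r + 4) + suc (8 * r + 14) ≡ 10 * r + 20
    arith = solve (r ∷ [])
  u-colour-tail (suc (suc (suc (suc _)))) (s≤s (s≤s (s≤s (s≤s ()))))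

  u-colour : ∀ {i} → i < suc (suc r) + suc (suc r) → suc (pendantLabel i) + suc (uLabel i) ≡ colour X Y i
  u-colour i<n with position i<n
  ... | regular i<2r =
    trans (cong₂ (λ a b → suc a + suc b) (⟨⟩++-< qRegular qTail i<2r) (⟨⟩++-< uRegular uTail i<2r)) (u-colour-regular i<2r)
  ... | tail j j<4 =
    trans (cong₂ (λ a b → suc a + suc b) (⟨⟩++-+ qRegular qTail (r + r) j) (⟨⟩++-+ uRegular uTail (r + r) j))
          (trans (u-colour-tail j j<4) (sym (colour-shift X Y r j)))

  v-colour-regular : ∀ {i} → i < r + r →
    colour (suc r + suc (suc r)) (suc (suc r) + suc (suc r)) i + (suc (qRegular i) + suc (vRegular i)) ≡ colour Y X i
  v-colour-regular {i} i<2r with parity i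
  ... | even k = begin
    colour (suc r + suc (suc r)) (suc (suc r) + suc (suc r)) (k + k) + (suc (qRegular (k + k)) + suc (vRegular (k + k)))
      ≡⟨ cong₂ _+_ (interleave-even (λ _ → suc r + suc (suc r)) (λ _ → suc (suc r) + suc (suc r)) k)
           (cong₂ (λ a b → suc a + suc b) (interleave-even (2 * r + 6 +_) (3 * r + 6 +_) k) (interleave-even vEven vOdd k)) ⟩
    suc r + suc (suc r) + (suc (2 * r + 6 + k) + suc (5 * r + 10 + (r ∸ suc k))) ≡⟨ rearrange-∸ (r ∸ suc k) ⟩
    9 * r + 20 + ((r ∸ suc k) + suc k)                   ≡⟨ cong (9 * r + 20 +_) (m∸n+n≡m (half-< i<2r)) ⟩
    9 * r + 20 + r                                       ≡⟨ solve (r ∷ []) ⟩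
    10 * r + 20                                          ≡⟨ interleave-even (λ _ → Y) (λ _ → X) k ⟨
    colour Y X (k + k)                                   ∎
    where
    open ≡-Reasoning
    rearrange-∸ : ∀ d → suc r + suc (suc r) + (suc (2 * r + 6 + k) + suc (5 * r + 10 + d)) ≡ 9 * r + 20 + (d + suc k)
    rearrange-∸ d = solve (r ∷ k ∷ d ∷ [])
  ... | odd k = begin
    colour (suc r + suc (suc r)) (suc (suc r) + suc (suc r)) (suc (k + k)) + (suc (qRegular (suc (k + k))) + suc (vRegular (suc (k + k))))
      ≡⟨ cong₂ _+_ (interleave-odd (λ _ → suc r + suc (suc r)) (λ _ → suc (suc r) + suc (suc r)) k)
           (cong₂ (λ a b → suc a + suc b) (interleave-odd (2 * r + 6 +_) (3 * r + 6 +_) k) (interleave-odd vEven vOdd k)) ⟩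
    suc (suc r) + suc (suc r) + (suc (3 * r + 6 + k) + suc (4 * r + 10 + (r ∸ suc k))) ≡⟨ rearrange-∸ (r ∸ suc k) ⟩
    9 * r + 21 + ((r ∸ suc k) + suc k)                   ≡⟨ cong (9 * r + 21 +_) (m∸n+n≡m (half-< (<-trans (n<1+n _) i<2r))) ⟩
    9 * r + 21 + r                                       ≡⟨ solve (r ∷ []) ⟩
    10 * r + 21                                          ≡⟨ interleave-odd (λ _ → Y) (λ _ → X) k ⟨
    colour Y X (suc (k + k))                             ∎
    where
    open ≡-Reasoning
    rearrange-∸ : ∀ d → suc (suc r) + suc (suc r) + (suc (3 * r + 6 + k) + suc (4 * r + 10 + d)) ≡ 9 * r + 21 + (d + suc k)
    rearrange-∸ d = solve (r ∷ k ∷ d ∷ [])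

  v-colour-tail : ∀ j → r + r + j < suc r + suc (suc r) →
    colour (suc r + suc (suc r)) (suc (suc r) + suc (suc r)) j + (suc (qTail j) + suc (vTail j)) ≡ colour Y X j
  v-colour-tail 0 _ = arith
    where
    arith : suc r + suc (suc r) + (suc (4 * r + 8) + suc (4 * r + 7)) ≡ 10 * r + 20
    arith = solve (r ∷ [])
  v-colour-tail 1 _ = arith
    where
    arith : suc (suc r) + suc (suc r) + (suc (6 * r + 12) + suc (2 * r + 3)) ≡ 10 * r + 21
    arith = solve (r ∷ [])
  v-colour-tail 2 _ = arith
    where
    arith : suc r + suc (suc r) + (suc (6 * r + 10) + suc (2 * r + 5)) ≡ 10 * r + 20
    arith = solve (r ∷ [])
  v-colour-tail (suc (suc (suc j))) 2r+3+j<2r+3 =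
    ⊥-elim (<⇒≱ 2r+3+j<2r+3 (≤-trans (≤-reflexive 2r+3≡) (+-monoʳ-≤ (r + r) (m≤m+n 3 j))))
    where
    2r+3≡ : suc r + suc (suc r) ≡ r + r + 3
    2r+3≡ = solve (r ∷ [])

  v-colour-inner : ∀ {i} → i < suc r + suc (suc r) →
    colour (suc r + suc (suc r)) (suc (suc r) + suc (suc r)) i + (suc (pendantLabel i) + suc (vLabel i)) ≡ colour Y X i
  v-colour-inner i<2r+3 with position (<-trans i<2r+3 (n<1+n _))
  ... | regular {i} i<2r =
    trans (cong (colour (suc r + suc (suc r)) (suc (suc r) + suc (suc r)) i +_)
                (cong₂ (λ a b → suc a + suc b) (⟨⟩++-< qRegular qTail i<2r) (⟨⟩++-< vRegular vTail i<2r)))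
          (v-colour-regular i<2r)
  ... | tail j _ =
    trans (cong₂ _+_ (colour-shift (suc r + suc (suc r)) (suc (suc r) + suc (suc r)) r j)
                     (cong₂ (λ a b → suc a + suc b) (⟨⟩++-+ qRegular qTail (r + r) j) (⟨⟩++-+ vRegular vTail (r + r) j)))
          (trans (v-colour-tail j i<2r+3) (sym (colour-shift Y X r j)))

  v-colour-last : suc (suc r) + (suc (pendantLabel (suc r + suc (suc r))) + suc (vLabel (suc r + suc (suc r))))
    ≡ colour Y X (suc r + suc (suc r))
  v-colour-last = begin
    suc (suc r) + (suc (pendantLabel (suc r + suc (suc r))) + suc (vLabel (suc r + suc (suc r))))
      ≡⟨ cong (λ i → suc (suc r) + (suc (pendantLabel i) + suc (vLabel i))) 2r+3≡ ⟩
    suc (suc r) + (suc (pendantLabel (r + r + 3)) + suc (vLabel (r + r + 3)))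
      ≡⟨ cong (suc (suc r) +_)
           (cong₂ (λ a b → suc a + suc b) (⟨⟩++-+ qRegular qTail (r + r) 3) (⟨⟩++-+ vRegular vTail (r + r) 3)) ⟩
    suc (suc r) + (suc (2 * r + 4) + suc (7 * r + 13)) ≡⟨ solve (r ∷ []) ⟩
    10 * r + 21                                        ≡⟨ colour-shift Y X r 3 ⟨
    colour Y X (r + r + 3)                             ≡⟨ cong (colour Y X) 2r+3≡ ⟨
    colour Y X (suc r + suc (suc r))                   ∎
    where
    open ≡-Reasoning
    2r+3≡ : suc r + suc (suc r) ≡ r + r + 3
    2r+3≡ = solve (r ∷ [])

  v-colour : ∀ {i} → i < suc (suc r) + suc (suc r) →
    incidenceSum (suc (suc r) + suc (suc r) + i) (pathEdges (suc (suc r) + suc (suc r))) (suc ∘ zigzag (suc r + suc (suc r)))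
      + (suc (pendantLabel i) + suc (vLabel i)) ≡ colour Y X i
  v-colour {i} i<n with i <? suc r + suc (suc r)
  ... | yes i<2r+3 =
    trans (cong (_+ (suc (pendantLabel i) + suc (vLabel i))) (incidenceSum-zigzag (suc (suc r) + suc (suc r)) i<2r+3))
          (v-colour-inner i<2r+3)
  ... | no i≮2r+3 with refl ← ≤-antisym (≤-pred i<n) (≮⇒≥ i≮2r+3) =
    trans (cong (_+ (suc (pendantLabel (suc r + suc (suc r))) + suc (vLabel (suc r + suc (suc r)))))
                (trans (incidenceSum-path-last (suc (suc r) + suc (suc r)) (suc ∘ zigzag (suc r + suc (suc r))) (s≤s z≤n))
                       (trans (zigzag-last (suc r + suc (suc r)) (s≤s z≤n)) half)))
          v-colour-last
    where
    half : ⌈ suc r + suc (suc r) /2⌉ ≡ suc (suc r)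
    half = cong suc (trans (cong ⌊_/2⌋ (+-suc r (suc r))) (sym (n≡⌊n+n/2⌋ (suc r))))

  χla≡3-even : ChiLa≡ (firecrackerJoinK1 (suc (suc r) + suc (suc r))) 3
  χla≡3-even = χla≡3-alternating (s≤s (s≤s z≤n)) labeling labeling-bijective (<⇒≢ Y<X ∘ sym)
    (λ i<n → trans (weight-u i<n) (u-colour i<n))
    (λ i<n → trans (weight-v i<n) (v-colour i<n))
    (<⇒≢ X<W) (<⇒≢ (<-trans Y<X X<W))
    where
    Y<X : Y < X
    Y<X = +-monoʳ-< (10 * r) ≤-refl
    bound : X < 2 * (suc (suc r) + suc (suc r)) * 3
    bound = subst (suc (10 * r + 21) ≤_) expand (m≤m+n (suc (10 * r + 21)) (2 * r + 2))
      where
      expand : suc (10 * r + 21) + (2 * r + 2) ≡ 2 * (suc (suc r) + suc (suc r)) * 3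
      expand = solve (r ∷ [])
    2≤ : ∀ a b → 2 ≤ a + suc (suc b)
    2≤ a b = ≤-trans (s≤s (s≤s z≤n)) (m≤n+m (suc (suc b)) a)
    2≤u : ∀ i → 2 ≤ uLabel i
    2≤u = ⟨⟩++-≥ (r + r) (interleave-≥ (λ k → ≤-trans (2≤ (7 * r) 12) (m≤m+n _ _))
                                       (λ k → ≤-trans (2≤ (6 * r) 11) (m≤m+n _ _))) tail≥
      where
      tail≥ : ∀ j → 2 ≤ uTail j
      tail≥ 0 = 2≤ (6 * r) 9
      tail≥ 1 = 2≤ (4 * r) 4
      tail≥ 2 = 2≤ (4 * r) 7
      tail≥ (suc (suc (suc _))) = 2≤ (8 * r) 12
    2≤v : ∀ i → 2 ≤ vLabel i
    2≤v = ⟨⟩++-≥ (r + r) (interleave-≥ (λ k → ≤-trans (2≤ (5 * r) 8) (m≤m+n _ _))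
                                       (λ k → ≤-trans (2≤ (4 * r) 8) (m≤m+n _ _))) tail≥
      where
      tail≥ : ∀ j → 2 ≤ vTail j
      tail≥ 0 = 2≤ (4 * r) 5
      tail≥ 1 = 2≤ (2 * r) 1
      tail≥ 2 = 2≤ (2 * r) 3
      tail≥ (suc (suc (suc _))) = 2≤ (7 * r) 11
    X<W : X < weight (firecrackerJoinK1 (suc (suc r) + suc (suc r))) labeling (2 * (suc (suc r) + suc (suc r)))
    X<W = <-≤-trans bound (weight-w-≥ 2≤u 2≤v)

χla≡3-byParity : ∀ {n} → Parity n → 3 ≤ n → ChiLa≡ (firecrackerJoinK1 n) 3
χla≡3-byParity (even (suc (suc r))) _ = EvenCase.χla≡3-even r
χla≡3-byParity (odd (suc h))       _ = OddCase.χla≡3-odd (suc h) (s≤s z≤n)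
χla≡3-byParity (even 0)            ()
χla≡3-byParity (even 1)            (s≤s (s≤s ()))
χla≡3-byParity (odd 0)             (s≤s ())

mainTheorem4 : (n : ℕ) → 3 ≤ n → ChiLa≡ (firecrackerJoinK1 n) 3
mainTheorem4 n = χla≡3-byParity (parity n)
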